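{- If $r_1\in\mathsf{SN}$ and $r_2\in\mathsf{SN}$, then $r_1\times r_2\in\mathsf{SN}$.
   Context: Types are generated by $A ::= \tau \mid A\Rightarrow A \mid A\wedge A$, where $\tau$ is the only atomic type ($\Rightarrow$ associates to the right). Type equivalence $\equiv$ is the smallest congruence on types such that $A\wedge B\equiv B\wedge A$, $A\wedge(B\wedge C)\equiv(A\wedge B)\wedge C$, $A\Rightarrow(B\wedge C)\equiv(A\Rightarrow B)\wedge(A\Rightarrow C)$ and $(A\wedge B)\Rightarrow C\equiv A\Rightarrow B\Rightarrow C$. To each type $A$ is associated an infinite set of variables $\mathcal V_A$, with $\mathcal V_A=\mathcal V_B$ if $A\equiv B$ and $\mathcal V_A\cap\mathcal V_B=\emptyset$ otherwise. Preterms are $r ::= x \mid \lambda x.r \mid rr \mid r\times r \mid \pi_A(r)$ (application left associative); one writes $\lambda x^A.r$ for $\lambda x.r$ when $x\in\mathcal V_A$. Introductions are abstractions and products; eliminations are applications and projections. Typing $r:A$ (without contexts): $x:A$ if $x\in\mathcal V_A$; if $r:A$ and $A\equiv B$ then $r:B$; if $r:B$ then $\lambda x^A.r:A\Rightarrow B$; if $r:A\Rightarrow B$ and $s:A$ then $rs:B$; if $r:A$ and $s:B$ then $r\times s:A\wedge B$; if $r:A\wedge B$ then $\pi_A(r):A$. Terms are well-typed preterms. $\rightleftarrows$ is the smallest symmetric relation, closed under all term contexts, containing $r\times s\rightleftarrows s\times r$, $(r\times s)\times t\rightleftarrows r\times(s\times t)$, $\lambda x^A.(r\times s)\rightleftarrows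 \lambda x^A.r\times\lambda x^A.s$, $rst\rightleftarrows r(s\times t)$; $\rightleftarrows^*$ is its reflexive transitive closure. Reduction: $\to_{\beta\pi\zeta}$: if $s:A$ then $(\lambda x^A.r)s\to_{\beta\pi\zeta} r[s/x]$; if $r:A$ then $\pi_A(r\times s)\to_{\beta\pi\zeta} r$; $(r\times s)t\to_{\beta\pi\zeta} rt\times st$. $\to_{\eta\delta}$: if $r:A\Rightarrow B$, $r$ is an elimination or a variable, and $x\in\mathcal V_A$ fresh, then $r\to_{\eta\delta}\lambda x^A.(rx)$; if $r:A\wedge B$ and $r$ is an elimination or a variable, then $r\to_{\eta\delta}\pi_A(r)\times\pi_B(r)$. The relations $\hookrightarrow$ and $\to$ are the smallest relations such that: $r\to_{\beta\pi\zeta}s$ implies $r\hookrightarrow s$; $r\to_{\eta\delta}s$ implies $r\to s$; $r\hookrightarrow s$ implies $r\to s$; $r\to s$ implies $\lambda x.r\hookrightarrow\lambda x.s$; $r\hookrightarrow s$ implies $rt\hookrightarrow st$; $r\to s$ implies $tr\hookrightarrow ts$, $r\times t\hookrightarrow s\times t$, $t\times r\hookrightarrow t\times s$; $r\hookrightarrow s$ implies $\pi_A(r)\hookrightarrow\pi_A(s)$. $r\rightsquigarrow s$ iff $r\rightleftarrows^* r'\to s'\rightleftarrows^* s$ for some $r',s'$. $\mathsf{SN}$ is the set of terms $r$ admitting no infinite sequence $r\rightsquigarrow r_1\rightsquigarrow r_2\rightsquigarrow\cdots$. -}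

module Defs where

open import Data.Nat using (ℕ; zero; suc; _⊔_)
import Data.Nat as ℕ
open import Data.List using (List; []; _∷_; filter; concatMap; foldr)
open import Data.Product using (_×_; _,_; ∃; ∃-syntax)
open import Data.Sum using (_⊎_)
open import Data.Bool using (if_then_else_)
open import Relation.Nullary using (Dec; yes; no; ¬_)
open import Relation.Nullary.Decidable using (⌊_⌋; ¬?)
open import Relation.Binary.PropositionalEquality using (_≡_; refl; cong; cong₂)
open import Data.List.Membership.Propositional using (_∉_)
open import Relation.Binary.Construct.Closure.ReflexiveTransitive using (Star)
open import Induction.WellFounded using (Acc)

infixr 7 _⇒_
infixr 8 _∧_

data Ty : Set where
  τ   : Ty
  _⇒_ : Ty → Ty → Ty
  _∧_ : Ty → Ty → Ty

infix 4 _≡ᵀ_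
data _≡ᵀ_ : Ty → Ty → Set where
  ≡ᵀ-refl  : ∀ {A} → A ≡ᵀ A
  ≡ᵀ-sym   : ∀ {A B} → A ≡ᵀ B → B ≡ᵀ A
  ≡ᵀ-trans : ∀ {A B C} → A ≡ᵀ B → B ≡ᵀ C → A ≡ᵀ C
  ≡ᵀ-⇒     : ∀ {A A' B B'} → A ≡ᵀ A' → B ≡ᵀ B' → (A ⇒ B) ≡ᵀ (A' ⇒ B')
  ≡ᵀ-∧     : ∀ {A A' B B'} → A ≡ᵀ A' → B ≡ᵀ B' → (A ∧ B) ≡ᵀ (A' ∧ B')
  ≡ᵀ-comm  : ∀ {A B} → (A ∧ B) ≡ᵀ (B ∧ A)
  ≡ᵀ-assoc : ∀ {A B C} → (A ∧ (B ∧ C)) ≡ᵀ ((A ∧ B) ∧ C)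
  ≡ᵀ-distr : ∀ {A B C} → (A ⇒ (B ∧ C)) ≡ᵀ ((A ⇒ B) ∧ (A ⇒ C))
  ≡ᵀ-curry : ∀ {A B C} → ((A ∧ B) ⇒ C) ≡ᵀ (A ⇒ B ⇒ C)

private
  ⇒-inj : ∀ {A B C D} → (A ⇒ B) ≡ (C ⇒ D) → A ≡ C × B ≡ D
  ⇒-inj refl = refl , refl
  ∧-inj : ∀ {A B C D} → (A ∧ B) ≡ (C ∧ D) → A ≡ C × B ≡ D
  ∧-inj refl = refl , refl

_≟ᵀ_ : (A B : Ty) → Dec (A ≡ B)
τ ≟ᵀ τ = yes refl
τ ≟ᵀ (_ ⇒ _) = no λ ()
τ ≟ᵀ (_ ∧ _) = no λ ()
(_ ⇒ _) ≟ᵀ τ = no λ ()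
(_ ⇒ _) ≟ᵀ (_ ∧ _) = no λ ()
(_ ∧ _) ≟ᵀ τ = no λ ()
(_ ∧ _) ≟ᵀ (_ ⇒ _) = no λ ()
(A ⇒ B) ≟ᵀ (C ⇒ D) with A ≟ᵀ C | B ≟ᵀ D
... | yes refl | yes refl = yes refl
... | no ne | _ = no λ e → ne (Data.Product.proj₁ (⇒-inj e))
... | _ | no ne = no λ e → ne (Data.Product.proj₂ (⇒-inj e))
(A ∧ B) ≟ᵀ (C ∧ D) with A ≟ᵀ C | B ≟ᵀ D
... | yes refl | yes refl = yes refl
... | no ne | _ = no λ e → ne (Data.Product.proj₁ (∧-inj e))
... | _ | no ne = no λ e → ne (Data.Product.proj₂ (∧-inj e))

-- Variables.  A variable is a pair (B , n); it belongs to 𝒱_A iff B ≡ᵀ A.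
-- Thus 𝒱_A is infinite, 𝒱_A = 𝒱_B when A ≡ᵀ B, and disjoint otherwise.

record Var : Set where
  constructor var
  field
    ty  : Ty
    idx : ℕ
open Var public

_∈𝒱_ : Var → Ty → Set
x ∈𝒱 A = ty x ≡ᵀ A

_≟ᵛ_ : (x y : Var) → Dec (x ≡ y)
var A n ≟ᵛ var B m with A ≟ᵀ B | n ℕ.≟ m
... | yes refl | yes refl = yes refl
... | no ne | _ = no λ { refl → ne refl }
... | _ | no ne = no λ { refl → ne refl }

infixl 9 _·_
infixr 6 _⊗_

data Tm : Set where
  `_  : Var → Tm
  ƛ   : Var → Tm → Tm
  _·_ : Tm → Tm → Tm
  _⊗_ : Tm → Tm → Tm
  π   : Ty → Tm → Tm

fv : Tm → List Var
fv (` x)   = x ∷ []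
fv (ƛ x r) = filter (λ y → ¬? (y ≟ᵛ x)) (fv r)
fv (r · s) = Data.List._++_ (fv r) (fv s)
fv (r ⊗ s) = Data.List._++_ (fv r) (fv s)
fv (π _ r) = fv r

-- capture-avoiding simultaneous substitution (bound variables are always
-- renamed to a fresh variable of the same type)
maxIdx : List Var → ℕ
maxIdx = foldr (λ y m → idx y ⊔ m) 0

extend : (Var → Tm) → Var → Tm → (Var → Tm)
extend σ x t y = if ⌊ y ≟ᵛ x ⌋ then t else σ y

sub : (Var → Tm) → Tm → Tm
sub σ (` x)   = σ x
sub σ (ƛ y r) =
  let z = var (ty y) (suc (maxIdx (concatMap (λ w → fv (σ w)) (fv (ƛ y r)))))
  in ƛ z (sub (extend σ y (` z)) r)
sub σ (r · s) = sub σ r · sub σ s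
sub σ (r ⊗ s) = sub σ r ⊗ sub σ s
sub σ (π A r) = π A (sub σ r)

_[_/_] : Tm → Tm → Var → Tm
r [ s / x ] = sub (extend `_ x s) r

infix 4 _∶_
data _∶_ : Tm → Ty → Set where
  ty-var  : ∀ {x A} → x ∈𝒱 A → ` x ∶ A
  ty-conv : ∀ {r A B} → r ∶ A → A ≡ᵀ B → r ∶ B
  ty-lam  : ∀ {x r A B} → x ∈𝒱 A → r ∶ B → ƛ x r ∶ A ⇒ B
  ty-app  : ∀ {r s A B} → r ∶ A ⇒ B → s ∶ A → r · s ∶ B
  ty-pair : ∀ {r s A B} → r ∶ A → s ∶ B → r ⊗ s ∶ A ∧ B
  ty-proj : ∀ {r A B} → r ∶ A ∧ B → π A r ∶ A

Term : Tm → Set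
Term r = ∃[ A ] (r ∶ A)

infix 4 _⇄_
data _⇄_ : Tm → Tm → Set where
  ⇄-comm  : ∀ {r s} → r ⊗ s ⇄ s ⊗ r
  ⇄-assoc : ∀ {r s t} → (r ⊗ s) ⊗ t ⇄ r ⊗ (s ⊗ t)
  ⇄-dist  : ∀ {x r s} → ƛ x (r ⊗ s) ⇄ ƛ x r ⊗ ƛ x s
  ⇄-curry : ∀ {r s t} → r · s · t ⇄ r · (s ⊗ t)
  ⇄-sym   : ∀ {r s} → r ⇄ s → s ⇄ r
  ⇄-lam   : ∀ {x r s} → r ⇄ s → ƛ x r ⇄ ƛ x s
  ⇄-appˡ  : ∀ {r s t} → r ⇄ s → r · t ⇄ s · t
  ⇄-appʳ  : ∀ {r s t} → r ⇄ s → t · r ⇄ t · s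
  ⇄-pairˡ : ∀ {r s t} → r ⇄ s → r ⊗ t ⇄ s ⊗ t
  ⇄-pairʳ : ∀ {r s t} → r ⇄ s → t ⊗ r ⇄ t ⊗ s
  ⇄-proj  : ∀ {A r s} → r ⇄ s → π A r ⇄ π A s

-- α-conversion (the paper works implicitly up to renaming of bound variables)
infix 4 _=α_
data _=α_ : Tm → Tm → Set where
  α-rename : ∀ {x y r} → ty y ≡ᵀ ty x → y ∉ fv (ƛ x r) → ƛ x r =α ƛ y (r [ ` y / x ])
  α-sym    : ∀ {r s} → r =α s → s =α r
  α-lam    : ∀ {x r s} → r =α s → ƛ x r =α ƛ x s
  α-appˡ   : ∀ {r s t} → r =α s → r · t =α s · t
  α-appʳ   : ∀ {r s t} → r =α s → t · r =α t · s
  α-pairˡ  : ∀ {r s t} → r =α s → r ⊗ t =α s ⊗ t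
  α-pairʳ  : ∀ {r s t} → r =α s → t ⊗ r =α t ⊗ s
  α-proj   : ∀ {A r s} → r =α s → π A r =α π A s

ConvStep : Tm → Tm → Set
ConvStep r s = Term r × Term s × (r ⇄ s ⊎ r =α s)

infix 4 _⇄*_
_⇄*_ : Tm → Tm → Set
_⇄*_ = Star ConvStep

infix 4 _→βπζ_ _→ηδ_ _↪_ _⟶_ _⇝_

data _→βπζ_ : Tm → Tm → Set where
  β : ∀ {x A r s} → x ∈𝒱 A → s ∶ A → ƛ x r · s →βπζ r [ s / x ]
  π-red : ∀ {A r s} → r ∶ A → π A (r ⊗ s) →βπζ r
  ζ : ∀ {r s t} → (r ⊗ s) · t →βπζ r · t ⊗ s · t

data ElimOrVar : Tm → Set where
  ev-var  : ∀ {x} → ElimOrVar (` x)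
  ev-app  : ∀ {r s} → ElimOrVar (r · s)
  ev-proj : ∀ {A r} → ElimOrVar (π A r)

data _→ηδ_ : Tm → Tm → Set where
  η : ∀ {r x A B} → r ∶ A ⇒ B → ElimOrVar r → x ∈𝒱 A → x ∉ fv r →
      r →ηδ ƛ x (r · ` x)
  δ : ∀ {r A B} → r ∶ A ∧ B → ElimOrVar r → r →ηδ π A r ⊗ π B r

mutual
  data _↪_ : Tm → Tm → Set where
    ↪-βπζ  : ∀ {r s} → r →βπζ s → r ↪ s
    ↪-lam  : ∀ {x r s} → r ⟶ s → ƛ x r ↪ ƛ x s
    ↪-appˡ : ∀ {r s t} → r ↪ s → r · t ↪ s · t
    ↪-appʳ : ∀ {r s t} → r ⟶ s → t · r ↪ t · s
    ↪-pairˡ : ∀ {r s t} → r ⟶ s → r ⊗ t ↪ s ⊗ t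
    ↪-pairʳ : ∀ {r s t} → r ⟶ s → t ⊗ r ↪ t ⊗ s
    ↪-proj : ∀ {A r s} → r ↪ s → π A r ↪ π A s

  data _⟶_ : Tm → Tm → Set where
    ⟶-ηδ : ∀ {r s} → r →ηδ s → r ⟶ s
    ⟶-↪  : ∀ {r s} → r ↪ s → r ⟶ s

_⇝_ : Tm → Tm → Set
r ⇝ s = Term r × Term s × ∃[ r' ] ∃[ s' ] (r ⇄* r' × r' ⟶ s' × s' ⇄* s)

SN : Tm → Set
SN r = Term r × Acc (λ s t → t ⇝ s) r

module Submission where

-- Every term t is, up to ⇄*, the right-nested product of its components
-- comps t: its maximal non-product parts, with abstractions distributed over
-- products (flatten).  Conversions only permute components or convert single
-- components, so r ⇄* s relates comps r and comps s by the equivalence ≈ᶜ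
-- generated by permutations and componentwise conversion (compsConv*).  The
-- delicate case is α-renaming a binder, which acts on every component below
-- it; it needs a small theory of renaming up to α.  A reduction step u ⟶ v
-- rewrites one component c of u into some d (focus⟶).  Hence if
-- a ⊗ b ⇄* u ⟶ v, the rewritten component stems from a or from b, and
-- v ⇄* a' ⊗ b with a ⇝ a' or v ⇄* a ⊗ b' with b ⇝ b' (productStep).  Nested
-- induction on the accessibility of a and b concludes (accProduct).

open import Defs
open import Data.Nat as ℕ using (suc)
import Data.Nat.Properties as ℕP
open import Data.List using (List; []; _∷_; _++_; map; concatMap; concat)
import Data.List.Properties as LP
open import Data.List.Relation.Unary.All as All using (All; []; _∷_)
import Data.List.Relation.Unary.All.Properties as AllP
open import Data.List.Relation.Unary.Any using (here; there)
open import Data.List.Membership.Propositional using (_∈_; _∉_; lose)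
import Data.List.Membership.Propositional.Properties as MP
open import Data.List.Relation.Binary.Pointwise as PW using (Pointwise; []; _∷_)
open import Data.List.Relation.Binary.Permutation.Propositional
  using (_↭_; refl; prep; swap; trans; ↭-sym; ↭-reflexive)
import Data.List.Relation.Binary.Permutation.Propositional.Properties as PP
open import Data.Product using (_×_; _,_; proj₁; proj₂; ∃; ∃-syntax; ∃₂)
open import Data.Sum as Sum using (_⊎_; inj₁; inj₂)
open import Data.Empty using (⊥-elim)
open import Relation.Nullary using (¬_; yes; no)
open import Relation.Nullary.Decidable using (¬?)
open import Relation.Binary.PropositionalEquality
  using (_≡_; _≢_; refl; sym; cong; cong₂; subst; module ≡-Reasoning)
import Relation.Binary.PropositionalEquality as Eq
open import Relation.Binary.Construct.Closure.ReflexiveTransitive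
  using (Star; ε; _◅_; _◅◅_)
import Relation.Binary.Construct.Closure.ReflexiveTransitive as Star
open import Induction.WellFounded using (Acc; acc)
open import Function using (_∘_)

open ≡-Reasoning

inv-var : ∀ {x A} → ` x ∶ A → ty x ≡ᵀ A
inv-var (ty-conv d e) = ≡ᵀ-trans (inv-var d) e
inv-var (ty-var e) = e

inv-lam : ∀ {x r A} → ƛ x r ∶ A → ∃[ B ] (r ∶ B × (ty x ⇒ B) ≡ᵀ A)
inv-lam (ty-conv d e) with inv-lam d
... | B , d' , e' = B , d' , ≡ᵀ-trans e' e
inv-lam (ty-lam x∈ d) = _ , d , ≡ᵀ-⇒ x∈ ≡ᵀ-refl

inv-app : ∀ {r s A} → r · s ∶ A → ∃₂ λ B C → r ∶ B ⇒ C × s ∶ B × C ≡ᵀ A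
inv-app (ty-conv d e) with inv-app d
... | B , C , d1 , d2 , e' = B , C , d1 , d2 , ≡ᵀ-trans e' e
inv-app (ty-app d1 d2) = _ , _ , d1 , d2 , ≡ᵀ-refl

inv-pair : ∀ {r s A} → r ⊗ s ∶ A → ∃₂ λ B C → r ∶ B × s ∶ C × (B ∧ C) ≡ᵀ A
inv-pair (ty-conv d e) with inv-pair d
... | B , C , d1 , d2 , e' = B , C , d1 , d2 , ≡ᵀ-trans e' e
inv-pair (ty-pair d1 d2) = _ , _ , d1 , d2 , ≡ᵀ-refl

inv-proj : ∀ {B r A} → π B r ∶ A → ∃[ C ] (r ∶ B ∧ C × B ≡ᵀ A)
inv-proj (ty-conv d e) with inv-proj d
... | C , d' , e' = C , d' , ≡ᵀ-trans e' e
inv-proj (ty-proj d) = _ , d , ≡ᵀ-refl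

T-lam⁻ : ∀ {x r} → Term (ƛ x r) → Term r
T-lam⁻ (_ , d) = let (B , d' , _) = inv-lam d in B , d'

T-lam⁺ : ∀ {x r} → Term r → Term (ƛ x r)
T-lam⁺ {x} (B , d) = ty x ⇒ B , ty-lam ≡ᵀ-refl d

T-pairˡ : ∀ {r s} → Term (r ⊗ s) → Term r
T-pairˡ (_ , d) = let (B , _ , d1 , _) = inv-pair d in B , d1

T-pairʳ : ∀ {r s} → Term (r ⊗ s) → Term s
T-pairʳ (_ , d) = let (_ , C , _ , d2 , _) = inv-pair d in C , d2

T-pair : ∀ {r s} → Term r → Term s → Term (r ⊗ s)
T-pair (A , d1) (B , d2) = A ∧ B , ty-pair d1 d2

conv-sym : ∀ {r s} → ConvStep r s → ConvStep s r
conv-sym (tr , ts , e) = ts , tr , Sum.map ⇄-sym α-sym e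

⇄*-sym : ∀ {r s} → r ⇄* s → s ⇄* r
⇄*-sym = Star.reverse conv-sym

⇄*-target : ∀ {r s} → Term r → r ⇄* s → Term s
⇄*-target t ε = t
⇄*-target _ ((_ , t , _) ◅ c) = ⇄*-target t c

⇄*-source : ∀ {r s} → Term s → r ⇄* s → Term r
⇄*-source t ε = t
⇄*-source _ ((t , _ , _) ◅ _) = t

⇄-single : ∀ {r s} → Term r → Term s → r ⇄ s → r ⇄* s
⇄-single tr ts e = (tr , ts , inj₁ e) ◅ ε

⇄*-lam : ∀ {x r s} → r ⇄* s → ƛ x r ⇄* ƛ x s
⇄*-lam {x} = Star.gmap (ƛ x) λ (tr , ts , e) →
  T-lam⁺ tr , T-lam⁺ ts , Sum.map ⇄-lam α-lam e

⇄*-pairˡ : ∀ {r s t} → Term t → r ⇄* s → r ⊗ t ⇄* s ⊗ t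
⇄*-pairˡ {t = t} tt = Star.gmap (_⊗ t) λ (tr , ts , e) →
  T-pair tr tt , T-pair ts tt , Sum.map ⇄-pairˡ α-pairˡ e

⇄*-pairʳ : ∀ {r s t} → Term t → r ⇄* s → t ⊗ r ⇄* t ⊗ s
⇄*-pairʳ {t = t} tt = Star.gmap (t ⊗_) λ (tr , ts , e) →
  T-pair tt tr , T-pair tt ts , Sum.map ⇄-pairʳ α-pairʳ e

⇄*-pair : ∀ {r s r' s'} → Term r → Term s' → r ⇄* r' → s ⇄* s' → r ⊗ s ⇄* r' ⊗ s'
⇄*-pair tr ts' c1 c2 = ⇄*-pairʳ tr c2 ◅◅ ⇄*-pairˡ ts' c1

comps : Tm → List Tm
comps (` x) = ` x ∷ []
comps (ƛ x r) = map (ƛ x) (comps r)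
comps (r · s) = r · s ∷ []
comps (r ⊗ s) = comps r ++ comps s
comps (π A r) = π A r ∷ []

comps-nonempty : ∀ t → ∃₂ λ c cs → comps t ≡ c ∷ cs
comps-nonempty (` x) = _ , _ , refl
comps-nonempty (ƛ x r) with comps r | comps-nonempty r
... | _ | c , cs , refl = _ , _ , refl
comps-nonempty (r · s) = _ , _ , refl
comps-nonempty (r ⊗ s) with comps r | comps-nonempty r
... | _ | c , cs , refl = _ , _ , refl
comps-nonempty (π A r) = _ , _ , refl

Atomic : Tm → Set
Atomic c = comps c ≡ c ∷ []

comps-atomic : ∀ t {c} → c ∈ comps t → Atomic c
comps-atomic (` x) (here refl) = refl
comps-atomic (ƛ x r) m with MP.∈-map⁻ (ƛ x) m
... | c , m' , refl = cong (map (ƛ x)) (comps-atomic r m')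
comps-atomic (r · s) (here refl) = refl
comps-atomic (r ⊗ s) m with MP.∈-++⁻ (comps r) m
... | inj₁ m1 = comps-atomic r m1
... | inj₂ m2 = comps-atomic s m2
comps-atomic (π A r) (here refl) = refl

concatMap-atomic : ∀ xs → All Atomic xs → concatMap comps xs ≡ xs
concatMap-atomic [] [] = refl
concatMap-atomic (x ∷ xs) (ax ∷ axs) = cong₂ _++_ ax (concatMap-atomic xs axs)

-- Right-nested products of non-empty lists; the empty list is mapped to an
-- arbitrary variable and never arises from components.

prod : Tm → List Tm → Tm
prod x [] = x
prod x (y ∷ ys) = x ⊗ prod y ys

prodL : List Tm → Tm
prodL [] = ` var τ 0
prodL (x ∷ xs) = prod x xs

comps-prod : ∀ x xs → comps (prod x xs) ≡ concatMap comps (x ∷ xs)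
comps-prod x [] = sym (LP.++-identityʳ (comps x))
comps-prod x (y ∷ ys) = cong (comps x ++_) (comps-prod y ys)

comps-prodL-insert : ∀ B d A → comps (prodL (B ++ d ∷ A)) ≡ concatMap comps (B ++ d ∷ A)
comps-prodL-insert [] d A = comps-prod d A
comps-prodL-insert (x ∷ B) d A = comps-prod x (B ++ d ∷ A)

T-prodL : ∀ {xs} → All Term xs → Term (prodL xs)
T-prodL [] = τ , ty-var ≡ᵀ-refl
T-prodL (t ∷ []) = t
T-prodL (t ∷ ts@(_ ∷ _)) = T-pair t (T-prodL ts)

T-comps : ∀ {t} → Term t → All Term (comps t)
T-comps {` x} tt = tt ∷ []
T-comps {ƛ x r} tt = AllP.map⁺ (All.map T-lam⁺ (T-comps (T-lam⁻ tt)))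
T-comps {r · s} tt = tt ∷ []
T-comps {r ⊗ s} tt = AllP.++⁺ (T-comps (T-pairˡ tt)) (T-comps (T-pairʳ tt))
T-comps {π A r} tt = tt ∷ []

T-uncomps : ∀ {t} → All Term (comps t) → Term t
T-uncomps {` x} (t ∷ []) = t
T-uncomps {ƛ x r} ts = T-lam⁺ (T-uncomps (All.map T-lam⁻ (AllP.map⁻ ts)))
T-uncomps {r · s} (t ∷ []) = t
T-uncomps {r ⊗ s} ts = T-pair (T-uncomps (AllP.++⁻ˡ (comps r) ts)) (T-uncomps (AllP.++⁻ʳ (comps r) ts))
T-uncomps {π A r} (t ∷ []) = t

T-block : ∀ {v d} L1 L2 → Term v → comps v ≡ L1 ++ comps d ++ L2 → Term d
T-block {d = d} L1 L2 tv e =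
  T-uncomps (AllP.++⁻ˡ (comps d) (AllP.++⁻ʳ L1 (subst (All Term) e (T-comps tv))))

prod-assoc : ∀ x xs y ys → All Term (x ∷ xs) → All Term (y ∷ ys) →
             prod x xs ⊗ prod y ys ⇄* prod x (xs ++ y ∷ ys)
prod-assoc x [] y ys tx ty = ε
prod-assoc x (x2 ∷ xs) y ys (tx ∷ txs) tys =
  ⇄-single (T-pair (T-prodL (tx ∷ txs)) (T-prodL tys))
           (T-pair tx (T-pair (T-prodL txs) (T-prodL tys))) ⇄-assoc
  ◅◅ ⇄*-pairʳ tx (prod-assoc x2 xs y ys txs tys)

prod-dist : ∀ z x xs → All Term (x ∷ xs) → ƛ z (prod x xs) ⇄* prod (ƛ z x) (map (ƛ z) xs)
prod-dist z x [] tx = ε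
prod-dist z x (x2 ∷ xs) (tx ∷ txs) =
  ⇄-single (T-lam⁺ (T-prodL (tx ∷ txs))) (T-pair (T-lam⁺ tx) (T-lam⁺ (T-prodL txs))) ⇄-dist
  ◅◅ ⇄*-pairʳ (T-lam⁺ tx) (prod-dist z x2 xs txs)

flatten : ∀ t → Term t → t ⇄* prodL (comps t)
flatten (` x) tt = ε
flatten (ƛ z r) tt with comps r | comps-nonempty r | flatten r (T-lam⁻ tt) | T-comps (T-lam⁻ tt)
... | _ | c , cs , refl | fl | tcs = ⇄*-lam fl ◅◅ prod-dist z c cs tcs
flatten (r · s) tt = ε
flatten (r ⊗ s) tt with comps r | comps-nonempty r | flatten r (T-pairˡ tt) | T-comps (T-pairˡ tt)
                      | comps s | comps-nonempty s | flatten s (T-pairʳ tt) | T-comps (T-pairʳ tt)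
... | _ | c , cs , refl | fl | tcs | _ | d , ds , refl | fl2 | tds =
  ⇄*-pair (T-pairˡ tt) (T-prodL tds) fl fl2 ◅◅ prod-assoc c cs d ds tcs tds
flatten (π A r) tt = ε

prodL-conv : ∀ {xs ys} → Pointwise _⇄*_ xs ys → All Term xs → prodL xs ⇄* prodL ys
prodL-conv [] _ = ε
prodL-conv (c ∷ []) _ = c
prodL-conv (c ∷ p@(_ ∷ _)) (t ∷ ts) =
  ⇄*-pair t (⇄*-target (T-prodL ts) (prodL-conv p ts)) c (prodL-conv p ts)

nonempty-↭-[] : ∀ {x : Tm} {xs} → ¬ ([] ↭ x ∷ xs)
nonempty-↭-[] p with PP.↭-length p
... | ()

prodL-perm : ∀ {xs ys} → xs ↭ ys → All Term xs → prodL xs ⇄* prodL ys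
prodL-perm refl _ = ε
prodL-perm {_ ∷ []} {_ ∷ []} (prep x p) _ = ε
prodL-perm {_ ∷ []} {_ ∷ _ ∷ _} (prep x p) _ = ⊥-elim (nonempty-↭-[] p)
prodL-perm {_ ∷ _ ∷ _} {_ ∷ []} (prep x p) _ = ⊥-elim (nonempty-↭-[] (↭-sym p))
prodL-perm {_ ∷ _ ∷ _} {_ ∷ _ ∷ _} (prep x p) (t ∷ ts) = ⇄*-pairʳ t (prodL-perm p ts)
prodL-perm {_ ∷ _ ∷ []} {_ ∷ _ ∷ []} (swap x y p) (tx ∷ ty ∷ []) =
  ⇄-single (T-pair tx ty) (T-pair ty tx) ⇄-comm
prodL-perm {_ ∷ _ ∷ []} {_ ∷ _ ∷ _ ∷ _} (swap x y p) _ = ⊥-elim (nonempty-↭-[] p)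
prodL-perm {_ ∷ _ ∷ _ ∷ _} {_ ∷ _ ∷ []} (swap x y p) _ = ⊥-elim (nonempty-↭-[] (↭-sym p))
prodL-perm {_ ∷ _ ∷ _ ∷ _} {_ ∷ _ ∷ _ ∷ _} (swap x y p) (tx ∷ ty ∷ ts) =
  let tP = T-prodL ts in
  ⇄-single (T-pair tx (T-pair ty tP)) (T-pair (T-pair tx ty) tP) (⇄-sym ⇄-assoc)
  ◅◅ ⇄-single (T-pair (T-pair tx ty) tP) (T-pair (T-pair ty tx) tP) (⇄-pairˡ ⇄-comm)
  ◅◅ ⇄-single (T-pair (T-pair ty tx) tP) (T-pair ty (T-pair tx tP)) ⇄-assoc
  ◅◅ ⇄*-pairʳ ty (⇄*-pairʳ tx (prodL-perm p ts))
prodL-perm (trans p q) ts = prodL-perm p ts ◅◅ prodL-perm q (PP.All-resp-↭ p ts)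

prodL-step : ∀ A1 {c d} A2 → c ⟶ d → prodL (A1 ++ c ∷ A2) ⟶ prodL (A1 ++ d ∷ A2)
prodL-step [] [] st = st
prodL-step [] (y ∷ ys) st = ⟶-↪ (↪-pairˡ st)
prodL-step (x ∷ []) A2 st = ⟶-↪ (↪-pairʳ (prodL-step [] A2 st))
prodL-step (x ∷ x2 ∷ A1) A2 st = ⟶-↪ (↪-pairʳ (prodL-step (x2 ∷ A1) A2 st))

data CompStep (xs ys : List Tm) : Set where
  perm : xs ↭ ys → CompStep xs ys
  conv : Pointwise _⇄*_ xs ys → CompStep xs ys

infix 4 _≈ᶜ_
_≈ᶜ_ : List Tm → List Tm → Set
_≈ᶜ_ = Star CompStep

≡⇒≈ᶜ : ∀ {xs ys} → xs ≡ ys → xs ≈ᶜ ys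
≡⇒≈ᶜ e = perm (↭-reflexive e) ◅ ε

≈ᶜ-sym : ∀ {xs ys} → xs ≈ᶜ ys → ys ≈ᶜ xs
≈ᶜ-sym = Star.reverse λ where
  (perm p) → perm (↭-sym p)
  (conv p) → conv (PW.symmetric ⇄*-sym p)

≈ᶜ-lam : ∀ {z xs ys} → xs ≈ᶜ ys → map (ƛ z) xs ≈ᶜ map (ƛ z) ys
≈ᶜ-lam {z} = Star.gmap (map (ƛ z)) λ where
  (perm p) → perm (PP.map⁺ (ƛ z) p)
  (conv p) → conv (PW.map⁺ (ƛ z) (ƛ z) (PW.map ⇄*-lam p))

≈ᶜ-++ˡ : ∀ zs {xs ys} → xs ≈ᶜ ys → zs ++ xs ≈ᶜ zs ++ ys
≈ᶜ-++ˡ zs = Star.gmap (zs ++_) λ where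
  (perm p) → perm (PP.++⁺ˡ zs p)
  (conv p) → conv (PW.++⁺ (PW.refl ε) p)

≈ᶜ-++ʳ : ∀ zs {xs ys} → xs ≈ᶜ ys → xs ++ zs ≈ᶜ ys ++ zs
≈ᶜ-++ʳ zs = Star.gmap (_++ zs) λ where
  (perm p) → perm (PP.++⁺ʳ zs p)
  (conv p) → conv (PW.++⁺ p (PW.refl ε))

≈ᶜ-insert : ∀ D K1 K2 L1 L2 → K1 ++ K2 ≈ᶜ L1 ++ L2 → K1 ++ D ++ K2 ≈ᶜ L1 ++ D ++ L2
≈ᶜ-insert D K1 K2 L1 L2 R =
  perm (PP.shifts K1 D) ◅ ≈ᶜ-++ˡ D R ◅◅ perm (↭-sym (PP.shifts L1 D)) ◅ ε

≈ᶜ-All : ∀ {xs ys} → xs ≈ᶜ ys → All Term xs → All Term ys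
≈ᶜ-All ε ts = ts
≈ᶜ-All (perm p ◅ R) ts = ≈ᶜ-All R (PP.All-resp-↭ p ts)
≈ᶜ-All (conv p ◅ R) ts = ≈ᶜ-All R (pw-All p ts)
  where
  pw-All : ∀ {xs ys} → Pointwise _⇄*_ xs ys → All Term xs → All Term ys
  pw-All [] [] = []
  pw-All (c ∷ p) (t ∷ ts) = ⇄*-target t c ∷ pw-All p ts

≈ᶜ-prodL : ∀ {xs ys} → xs ≈ᶜ ys → All Term xs → prodL xs ⇄* prodL ys
≈ᶜ-prodL ε _ = ε
≈ᶜ-prodL (perm p ◅ R) ts = prodL-perm p ts ◅◅ ≈ᶜ-prodL R (≈ᶜ-All (perm p ◅ ε) ts)
≈ᶜ-prodL (conv p ◅ R) ts = prodL-conv p ts ◅◅ ≈ᶜ-prodL R (≈ᶜ-All (conv p ◅ ε) ts)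

≈ᶜ⇒⇄* : ∀ {v w} → Term v → Term w → comps v ≈ᶜ comps w → v ⇄* w
≈ᶜ⇒⇄* {v} {w} tv tw R = flatten v tv ◅◅ ≈ᶜ-prodL R (T-comps tv) ◅◅ ⇄*-sym (flatten w tw)

Counterpart : List Tm → List Tm → Tm → List Tm → Set
Counterpart L L1 c L2 =
  ∃₂ λ K1 K2 → ∃ λ c0 → L ≡ K1 ++ c0 ∷ K2 × c0 ⇄* c × K1 ++ K2 ≈ᶜ L1 ++ L2

pointwise-split : ∀ L1 {c L2 L} → Pointwise _⇄*_ L (L1 ++ c ∷ L2) →
  ∃₂ λ K1 K2 → ∃ λ c0 → L ≡ K1 ++ c0 ∷ K2 × c0 ⇄* c × Pointwise _⇄*_ (K1 ++ K2) (L1 ++ L2)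
pointwise-split [] (h ∷ p) = [] , _ , _ , refl , h , p
pointwise-split (x ∷ L1) (h ∷ p) with pointwise-split L1 p
... | K1 , K2 , c0 , refl , hc , q = _ ∷ K1 , K2 , c0 , refl , hc , h ∷ q

counterpart : ∀ {L M} → L ≈ᶜ M → ∀ L1 c L2 → M ≡ L1 ++ c ∷ L2 → Counterpart L L1 c L2
counterpart ε L1 c L2 refl = L1 , L2 , c , refl , ε , ε
counterpart (perm p ◅ R) L1 c L2 e with counterpart R L1 c L2 e
... | M1 , M2 , c1 , refl , h1 , q1 with MP.∈-∃++ (PP.∈-resp-↭ (↭-sym p) (MP.∈-insert M1))
... | K1 , K2 , refl = K1 , K2 , c1 , refl , h1 , perm (PP.drop-mid K1 M1 p) ◅ q1
counterpart (conv p ◅ R) L1 c L2 e with counterpart R L1 c L2 e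
... | M1 , M2 , c1 , refl , h1 , q1 with pointwise-split M1 p
... | K1 , K2 , c0 , e0 , h0 , q0 = K1 , K2 , c0 , e0 , h0 ◅◅ h1 , conv q0 ◅ q1

extend-hit : ∀ σ x t → extend σ x t x ≡ t
extend-hit σ x t with x ≟ᵛ x
... | yes _ = refl
... | no x≢x = ⊥-elim (x≢x refl)

extend-miss : ∀ σ x t {y} → y ≢ x → extend σ x t y ≡ σ y
extend-miss σ x t {y} y≢x with y ≟ᵛ x
... | yes y≡x = ⊥-elim (y≢x y≡x)
... | no _ = refl

fv-lam⁻ : ∀ {v x r} → v ∈ fv (ƛ x r) → v ∈ fv r × v ≢ x
fv-lam⁻ {x = x} {r} = MP.∈-filter⁻ (λ y → ¬? (y ≟ᵛ x)) {xs = fv r}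

fv-lam⁺ : ∀ {v x r} → v ∈ fv r → v ≢ x → v ∈ fv (ƛ x r)
fv-lam⁺ {x = x} {r} = MP.∈-filter⁺ (λ y → ¬? (y ≟ᵛ x)) {xs = fv r}

-- The binder chosen by sub is fresh: its index exceeds every index of the
-- free variables of the substituted free variables.

idx-≤-maxIdx : ∀ {x L} → x ∈ L → idx x ℕ.≤ maxIdx L
idx-≤-maxIdx {x} {_ ∷ L} (here refl) = ℕP.m≤m⊔n (idx x) (maxIdx L)
idx-≤-maxIdx {L = y ∷ L} (there m) = ℕP.≤-trans (idx-≤-maxIdx m) (ℕP.m≤n⊔m (idx y) (maxIdx L))

freshBinder : (Var → Tm) → Var → Tm → Var
freshBinder σ y r = var (ty y) (suc (maxIdx (concatMap (λ w → fv (σ w)) (fv (ƛ y r)))))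

Fresh : (Var → Tm) → Tm → Var → Set
Fresh σ X x = ∀ {w} → w ∈ fv X → x ∉ fv (σ w)

freshBinder-fresh : ∀ σ y r → Fresh σ (ƛ y r) (freshBinder σ y r)
freshBinder-fresh σ y r hw hx =
  ℕP.<-irrefl refl (idx-≤-maxIdx (MP.∈-concatMap⁺ (λ w → fv (σ w)) (lose hw hx)))

fv-sub⁻ : ∀ r σ {v} → v ∈ fv (sub σ r) → ∃[ w ] (w ∈ fv r × v ∈ fv (σ w))
fv-sub⁻ (` x) σ h = x , here refl , h
fv-sub⁻ (ƛ y r) σ h with fv-lam⁻ {r = sub (extend σ y (` freshBinder σ y r)) r} h
... | h1 , v≢z with fv-sub⁻ r (extend σ y (` freshBinder σ y r)) h1
... | w , hw , hv with w ≟ᵛ y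
... | yes refl = ⊥-elim (v≢z (hit hv))
  where
  hit : ∀ {v z} → v ∈ fv (` z) → v ≡ z
  hit (here e) = e
... | no w≢y = w , fv-lam⁺ {r = r} hw w≢y , hv
fv-sub⁻ (r · s) σ h with MP.∈-++⁻ (fv (sub σ r)) h
... | inj₁ h1 = let (w , a , b) = fv-sub⁻ r σ h1 in w , MP.∈-++⁺ˡ a , b
... | inj₂ h1 = let (w , a , b) = fv-sub⁻ s σ h1 in w , MP.∈-++⁺ʳ (fv r) a , b
fv-sub⁻ (r ⊗ s) σ h with MP.∈-++⁻ (fv (sub σ r)) h
... | inj₁ h1 = let (w , a , b) = fv-sub⁻ r σ h1 in w , MP.∈-++⁺ˡ a , b
... | inj₂ h1 = let (w , a , b) = fv-sub⁻ s σ h1 in w , MP.∈-++⁺ʳ (fv r) a , b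
fv-sub⁻ (π A r) σ h = fv-sub⁻ r σ h

fv-sub⁺ : ∀ r σ {v w} → w ∈ fv r → v ∈ fv (σ w) → v ∈ fv (sub σ r)
fv-sub⁺ (` x) σ (here refl) hv = hv
fv-sub⁺ (ƛ y r) σ {v} {w} hw hv with fv-lam⁻ {r = r} hw
... | hw' , w≢y =
  fv-lam⁺ {r = sub (extend σ y (` z)) r}
    (fv-sub⁺ r (extend σ y (` z)) hw' (subst (λ t → v ∈ fv t) (sym (extend-miss σ y (` z) w≢y)) hv))
    (λ v≡z → freshBinder-fresh σ y r hw (subst (_∈ fv (σ w)) v≡z hv))
  where z = freshBinder σ y r
fv-sub⁺ (r · s) σ hw hv with MP.∈-++⁻ (fv r) hw
... | inj₁ h = MP.∈-++⁺ˡ (fv-sub⁺ r σ h hv)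
... | inj₂ h = MP.∈-++⁺ʳ (fv (sub σ r)) (fv-sub⁺ s σ h hv)
fv-sub⁺ (r ⊗ s) σ hw hv with MP.∈-++⁻ (fv r) hw
... | inj₁ h = MP.∈-++⁺ˡ (fv-sub⁺ r σ h hv)
... | inj₂ h = MP.∈-++⁺ʳ (fv (sub σ r)) (fv-sub⁺ s σ h hv)
fv-sub⁺ (π A r) σ hw hv = fv-sub⁺ r σ hw hv

-- Substitutions agreeing on the free variables of r act identically on r
-- (including the choice of fresh binders).
sub-cong : ∀ r σ σ' → (∀ {w} → w ∈ fv r → σ w ≡ σ' w) → sub σ r ≡ sub σ' r
sub-cong (` x) σ σ' h = h (here refl)
sub-cong (ƛ y r) σ σ' h
  with concatMap (λ w → fv (σ w)) (fv (ƛ y r)) | concatMap (λ w → fv (σ' w)) (fv (ƛ y r))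
     | cong concat (LP.map-cong-local (All.tabulate (λ m → cong fv (h m))))
... | L | .L | refl = cong (ƛ z) (sub-cong r _ _ agree)
  where
  z = var (ty y) (suc (maxIdx L))
  agree : ∀ {w} → w ∈ fv r → extend σ y (` z) w ≡ extend σ' y (` z) w
  agree {w} m with w ≟ᵛ y
  ... | yes _ = refl
  ... | no w≢y = h (fv-lam⁺ {r = r} m w≢y)
sub-cong (r · s) σ σ' h = cong₂ _·_ (sub-cong r σ σ' (h ∘ MP.∈-++⁺ˡ)) (sub-cong s σ σ' (h ∘ MP.∈-++⁺ʳ (fv r)))
sub-cong (r ⊗ s) σ σ' h = cong₂ _⊗_ (sub-cong r σ σ' (h ∘ MP.∈-++⁺ˡ)) (sub-cong s σ σ' (h ∘ MP.∈-++⁺ʳ (fv r)))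
sub-cong (π A r) σ σ' h = cong (π A) (sub-cong r σ σ' h)

infix 4 _~_
_~_ : Tm → Tm → Set
_~_ = Star _=α_

≡⇒~ : ∀ {r s} → r ≡ s → r ~ s
≡⇒~ refl = ε

~lam : ∀ {x r s} → r ~ s → ƛ x r ~ ƛ x s
~lam = Star.gmap _ α-lam

~app : ∀ {r r' s s'} → r ~ r' → s ~ s' → r · s ~ r' · s'
~app c1 c2 = Star.gmap _ α-appˡ c1 ◅◅ Star.gmap _ α-appʳ c2

~pair : ∀ {r r' s s'} → r ~ r' → s ~ s' → r ⊗ s ~ r' ⊗ s'
~pair c1 c2 = Star.gmap _ α-pairˡ c1 ◅◅ Star.gmap _ α-pairʳ c2

~proj : ∀ {A r s} → r ~ s → π A r ~ π A s
~proj = Star.gmap _ α-proj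

IsRen : (Var → Tm) → Set
IsRen σ = ∀ w → ∃[ v ] σ w ≡ ` v

id-ren : IsRen `_
id-ren w = w , refl

extend-ren : ∀ {σ} y z → IsRen σ → IsRen (extend σ y (` z))
extend-ren {σ} y z h w with w ≟ᵛ y
... | yes _ = z , refl
... | no _ = h w

ren-comp : ∀ {ρ σ} → IsRen ρ → IsRen σ → IsRen (λ w → sub ρ (σ w))
ren-comp {ρ} {σ} iρ iσ w with σ w | iσ w
... | _ | v , refl = iρ v

∉-var : ∀ {a b} → a ≢ b → a ∉ fv (` b)
∉-var a≢b (here e) = a≢b e

-- Two facts about renamings up to α, proved simultaneously:
-- successive renamings compose, and the binder introduced when renaming
-- under λ may be any fresh variable of the right type.

mutual
  sub-sub : ∀ r ρ σ → IsRen ρ → IsRen σ → sub ρ (sub σ r) ~ sub (λ w → sub ρ (σ w)) r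
  sub-sub (` x) ρ σ iρ iσ = ε
  sub-sub (ƛ y r) ρ σ iρ iσ =
    ~lam (sub-sub r ρ₁ σ₁ (extend-ren z₁ z₂ iρ) (extend-ren y z₁ iσ))
    ◅◅ ≡⇒~ (cong (ƛ z₂) (sub-cong r _ _ agree))
    ◅◅ sub-binder r y ρσ z₂ _ (ren-comp iρ iσ) refl refl z₂-fresh (freshBinder-fresh ρσ y r)
    where
    z₁ = freshBinder σ y r
    σ₁ = extend σ y (` z₁)
    z₂ = freshBinder ρ z₁ (sub σ₁ r)
    ρ₁ = extend ρ z₁ (` z₂)
    ρσ : Var → Tm
    ρσ w = sub ρ (σ w)
    agree : ∀ {w} → w ∈ fv r → sub ρ₁ (σ₁ w) ≡ extend ρσ y (` z₂) w
    agree {w} m with w ≟ᵛ y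
    ... | yes refl = extend-hit ρ z₁ (` z₂)
    ... | no w≢y with σ w | iσ w | freshBinder-fresh σ y r (fv-lam⁺ {r = r} m w≢y)
    ... | _ | v , refl | fr = extend-miss ρ z₁ (` z₂) (λ e → fr (here (sym e)))
    z₂-fresh : Fresh ρσ (ƛ y r) z₂
    z₂-fresh {w} hw hz with fv-lam⁻ {r = r} hw | iσ w
    ... | hw' , w≢y | v , σw≡v =
      freshBinder-fresh ρ z₁ (sub σ₁ r)
        (fv-lam⁺ {r = sub σ₁ r}
          (fv-sub⁺ r σ₁ hw' (subst (λ t → v ∈ fv t) (sym (Eq.trans (extend-miss σ y (` z₁) w≢y) σw≡v)) (here refl)))
          (λ v≡z₁ → freshBinder-fresh σ y r hw (subst (λ t → z₁ ∈ fv t) (sym σw≡v) (here (sym v≡z₁)))))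
        (subst (λ t → z₂ ∈ fv (sub ρ t)) σw≡v hz)
  sub-sub (r · s) ρ σ iρ iσ = ~app (sub-sub r ρ σ iρ iσ) (sub-sub s ρ σ iρ iσ)
  sub-sub (r ⊗ s) ρ σ iρ iσ = ~pair (sub-sub r ρ σ iρ iσ) (sub-sub s ρ σ iρ iσ)
  sub-sub (π A r) ρ σ iρ iσ = ~proj (sub-sub r ρ σ iρ iσ)

  sub-binder : ∀ c z σ x₁ x₂ → IsRen σ → ty x₁ ≡ ty z → ty x₂ ≡ ty z →
               Fresh σ (ƛ z c) x₁ → Fresh σ (ƛ z c) x₂ →
               ƛ x₁ (sub (extend σ z (` x₁)) c) ~ ƛ x₂ (sub (extend σ z (` x₂)) c)
  sub-binder c z σ x₁ x₂ iσ e₁ e₂ f₁ f₂ =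
    α-rename same-ty x₂-fresh
    ◅ (~lam (sub-sub c ρ σ₁ (extend-ren x₁ x₂ id-ren) (extend-ren z x₁ iσ))
       ◅◅ ≡⇒~ (cong (ƛ x₂) (sub-cong c _ _ agree)))
    where
    ρ = extend `_ x₁ (` x₂)
    σ₁ = extend σ z (` x₁)
    same-ty : ty x₂ ≡ᵀ ty x₁
    same-ty = subst (_≡ᵀ ty x₁) (Eq.trans e₁ (sym e₂)) ≡ᵀ-refl
    x₂-fresh : x₂ ∉ fv (ƛ x₁ (sub σ₁ c))
    x₂-fresh h with fv-lam⁻ {r = sub σ₁ c} h
    ... | h1 , x₂≢x₁ with fv-sub⁻ c σ₁ h1
    ... | w , hw , hv with w ≟ᵛ z
    ... | yes refl = ∉-var x₂≢x₁ hv
    ... | no w≢z = f₂ (fv-lam⁺ {r = c} hw w≢z) hv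
    agree : ∀ {w} → w ∈ fv c → sub ρ (σ₁ w) ≡ extend σ z (` x₂) w
    agree {w} m with w ≟ᵛ z
    ... | yes refl = extend-hit `_ x₁ (` x₂)
    ... | no w≢z with σ w | iσ w | f₁ (fv-lam⁺ {r = c} m w≢z)
    ... | _ | v , refl | fr = extend-miss `_ x₁ (` x₂) (λ e → fr (here (sym e)))

comps-fv : ∀ r {c v} → c ∈ comps r → v ∈ fv c → v ∈ fv r
comps-fv (` x) (here refl) h = h
comps-fv (ƛ x r) m h with MP.∈-map⁻ (ƛ x) m
... | c , m' , refl with fv-lam⁻ {r = c} h
... | h1 , v≢x = fv-lam⁺ {r = r} (comps-fv r m' h1) v≢x
comps-fv (r · s) (here refl) h = h
comps-fv (r ⊗ s) m h with MP.∈-++⁻ (comps r) m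
... | inj₁ m1 = MP.∈-++⁺ˡ (comps-fv r m1 h)
... | inj₂ m2 = MP.∈-++⁺ʳ (fv r) (comps-fv s m2 h)
comps-fv (π A r) (here refl) h = h

~-map∘ : ∀ {f g h k : Tm → Tm} xs → (∀ {c} → c ∈ xs → f (g c) ~ h (k c)) →
         Pointwise _~_ (map f (map g xs)) (map h (map k xs))
~-map∘ [] H = []
~-map∘ (x ∷ xs) H = H (here refl) ∷ ~-map∘ xs (H ∘ there)

comps-sub : ∀ r σ → IsRen σ → Pointwise _~_ (comps (sub σ r)) (map (sub σ) (comps r))
comps-sub (` x) σ iσ with σ x | iσ x
... | _ | v , refl = ε ∷ []
comps-sub (ƛ z r) σ iσ =
  PW.transitive _◅◅_ (PW.map⁺ (ƛ z') (ƛ z') (PW.map ~lam (comps-sub r σ₁ (extend-ren z z' iσ))))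
                     (~-map∘ (comps r) binder-irrelevant)
  where
  z' = freshBinder σ z r
  σ₁ = extend σ z (` z')
  binder-irrelevant : ∀ {c} → c ∈ comps r → ƛ z' (sub σ₁ c) ~ sub σ (ƛ z c)
  binder-irrelevant {c} m =
    sub-binder c z σ z' (freshBinder σ z c) iσ refl refl
      (λ hw → let (h1 , w≢z) = fv-lam⁻ {r = c} hw in
              freshBinder-fresh σ z r (fv-lam⁺ {r = r} (comps-fv r m h1) w≢z))
      (freshBinder-fresh σ z c)
comps-sub (r · s) σ iσ = ε ∷ []
comps-sub (r ⊗ s) σ iσ rewrite LP.map-++ (sub σ) (comps r) (comps s) =
  PW.++⁺ (comps-sub r σ iσ) (comps-sub s σ iσ)
comps-sub (π A r) σ iσ = ε ∷ []

TypedRen : (Var → Tm) → Set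
TypedRen σ = ∀ w → ∃[ v ] (σ w ≡ ` v × ty v ≡ᵀ ty w)

extend-typedRen : ∀ {σ} → TypedRen σ → ∀ y z → ty z ≡ ty y → TypedRen (extend σ y (` z))
extend-typedRen {σ} tσ y z e w with w ≟ᵛ y
... | yes refl = z , refl , subst (_≡ᵀ ty w) (sym e) ≡ᵀ-refl
... | no _ = tσ w

sub-typing : ∀ r σ → TypedRen σ → ∀ {A} → r ∶ A → sub σ r ∶ A
sub-typing (` x) σ tσ d with σ x | tσ x
... | _ | v , refl , e = ty-var (≡ᵀ-trans e (inv-var d))
sub-typing (ƛ y r) σ tσ d with inv-lam d
... | B , d' , e = ty-conv (ty-lam ≡ᵀ-refl (sub-typing r _ (extend-typedRen tσ y (freshBinder σ y r) refl) d')) e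
sub-typing (r · s) σ tσ d with inv-app d
... | B , C , d1 , d2 , e = ty-conv (ty-app (sub-typing r σ tσ d1) (sub-typing s σ tσ d2)) e
sub-typing (r ⊗ s) σ tσ d with inv-pair d
... | B , C , d1 , d2 , e = ty-conv (ty-pair (sub-typing r σ tσ d1) (sub-typing s σ tσ d2)) e
sub-typing (π A r) σ tσ d with inv-proj d
... | C , d' , e = ty-conv (ty-proj (sub-typing r σ tσ d')) e

sub-typing⁻ : ∀ r σ → TypedRen σ → ∀ {A} → sub σ r ∶ A → r ∶ A
sub-typing⁻ (` x) σ tσ d with σ x | tσ x | d
... | _ | v , refl , e | d' = ty-var (≡ᵀ-trans (≡ᵀ-sym e) (inv-var d'))
sub-typing⁻ (ƛ y r) σ tσ d with inv-lam d
... | B , d' , e = ty-conv (ty-lam ≡ᵀ-refl (sub-typing⁻ r _ (extend-typedRen tσ y (freshBinder σ y r) refl) d')) e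
sub-typing⁻ (r · s) σ tσ d with inv-app d
... | B , C , d1 , d2 , e = ty-conv (ty-app (sub-typing⁻ r σ tσ d1) (sub-typing⁻ s σ tσ d2)) e
sub-typing⁻ (r ⊗ s) σ tσ d with inv-pair d
... | B , C , d1 , d2 , e = ty-conv (ty-pair (sub-typing⁻ r σ tσ d1) (sub-typing⁻ s σ tσ d2)) e
sub-typing⁻ (π A r) σ tσ d with inv-proj d
... | C , d' , e = ty-conv (ty-proj (sub-typing⁻ r σ tσ d')) e

rename-typedRen : ∀ x y → ty y ≡ᵀ ty x → TypedRen (extend `_ x (` y))
rename-typedRen x y e w with w ≟ᵛ x
... | yes refl = y , refl , e
... | no _ = w , refl , ≡ᵀ-refl

infix 4 _⊑ᵀ_
_⊑ᵀ_ : Tm → Tm → Set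
r ⊑ᵀ s = ∀ {A} → s ∶ A → r ∶ A

⊑ᵀ-lam : ∀ {x r s} → r ⊑ᵀ s → ƛ x r ⊑ᵀ ƛ x s
⊑ᵀ-lam f d = let (_ , d' , e) = inv-lam d in ty-conv (ty-lam ≡ᵀ-refl (f d')) e

⊑ᵀ-appˡ : ∀ {r s t} → r ⊑ᵀ s → r · t ⊑ᵀ s · t
⊑ᵀ-appˡ f d = let (_ , _ , d1 , d2 , e) = inv-app d in ty-conv (ty-app (f d1) d2) e

⊑ᵀ-appʳ : ∀ {r s t} → r ⊑ᵀ s → t · r ⊑ᵀ t · s
⊑ᵀ-appʳ f d = let (_ , _ , d1 , d2 , e) = inv-app d in ty-conv (ty-app d1 (f d2)) e

⊑ᵀ-pairˡ : ∀ {r s t} → r ⊑ᵀ s → r ⊗ t ⊑ᵀ s ⊗ t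
⊑ᵀ-pairˡ f d = let (_ , _ , d1 , d2 , e) = inv-pair d in ty-conv (ty-pair (f d1) d2) e

⊑ᵀ-pairʳ : ∀ {r s t} → r ⊑ᵀ s → t ⊗ r ⊑ᵀ t ⊗ s
⊑ᵀ-pairʳ f d = let (_ , _ , d1 , d2 , e) = inv-pair d in ty-conv (ty-pair d1 (f d2)) e

⊑ᵀ-proj : ∀ {A r s} → r ⊑ᵀ s → π A r ⊑ᵀ π A s
⊑ᵀ-proj f d = let (_ , d' , e) = inv-proj d in ty-conv (ty-proj (f d')) e

α-typing : ∀ {r s} → r =α s → s ⊑ᵀ r × r ⊑ᵀ s
α-typing (α-rename {x} {y} {r} e _) =
  (λ d → let (_ , d' , eA) = inv-lam d in
     ty-conv (ty-lam ≡ᵀ-refl (sub-typing r _ (rename-typedRen x y e) d')) (≡ᵀ-trans (≡ᵀ-⇒ e ≡ᵀ-refl) eA)) ,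
  (λ d → let (_ , d' , eA) = inv-lam d in
     ty-conv (ty-lam ≡ᵀ-refl (sub-typing⁻ r _ (rename-typedRen x y e) d')) (≡ᵀ-trans (≡ᵀ-⇒ (≡ᵀ-sym e) ≡ᵀ-refl) eA))
α-typing (α-sym p) = let (f , g) = α-typing p in g , f
α-typing (α-lam p) = let (f , g) = α-typing p in ⊑ᵀ-lam f , ⊑ᵀ-lam g
α-typing (α-appˡ p) = let (f , g) = α-typing p in ⊑ᵀ-appˡ f , ⊑ᵀ-appˡ g
α-typing (α-appʳ p) = let (f , g) = α-typing p in ⊑ᵀ-appʳ f , ⊑ᵀ-appʳ g
α-typing (α-pairˡ p) = let (f , g) = α-typing p in ⊑ᵀ-pairˡ f , ⊑ᵀ-pairˡ g
α-typing (α-pairʳ p) = let (f , g) = α-typing p in ⊑ᵀ-pairʳ f , ⊑ᵀ-pairʳ g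
α-typing (α-proj p) = let (f , g) = α-typing p in ⊑ᵀ-proj f , ⊑ᵀ-proj g

~⇒⇄* : ∀ {r s} → Term r → r ~ s → r ⇄* s
~⇒⇄* tr ε = ε
~⇒⇄* (A , d) (p ◅ c) = let d' = proj₁ (α-typing p) d in ((A , d) , (A , d') , inj₂ p) ◅ ~⇒⇄* (A , d') c

~⇒⇄*-pointwise : ∀ {xs ys} → All Term xs → Pointwise _~_ xs ys → Pointwise _⇄*_ xs ys
~⇒⇄*-pointwise [] [] = []
~⇒⇄*-pointwise (t ∷ ts) (c ∷ p) = ~⇒⇄* t c ∷ ~⇒⇄*-pointwise ts p

-- Invariance of components under conversion.  Commutation, association and
-- distribution permute or regroup components; all other conversions happen
-- inside a single component or under a binder.

atomic-conv : ∀ {r s} → Atomic r → Atomic s → ConvStep r s → comps r ≈ᶜ comps s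
atomic-conv ar as st rewrite ar | as = conv ((st ◅ ε) ∷ []) ◅ ε

compsConv⇄ : ∀ {r s} → Term r → Term s → r ⇄ s → comps r ≈ᶜ comps s
compsConv⇄ tr ts (⇄-comm {r} {s}) = perm (PP.++-comm (comps r) (comps s)) ◅ ε
compsConv⇄ tr ts (⇄-assoc {r} {s} {t}) = ≡⇒≈ᶜ (LP.++-assoc (comps r) (comps s) (comps t))
compsConv⇄ tr ts (⇄-dist {x} {r} {s}) = ≡⇒≈ᶜ (LP.map-++ (ƛ x) (comps r) (comps s))
compsConv⇄ tr ts e@⇄-curry = atomic-conv refl refl (tr , ts , inj₁ e)
compsConv⇄ tr ts (⇄-sym e) = ≈ᶜ-sym (compsConv⇄ ts tr e)
compsConv⇄ tr ts (⇄-lam e) = ≈ᶜ-lam (compsConv⇄ (T-lam⁻ tr) (T-lam⁻ ts) e)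
compsConv⇄ tr ts e@(⇄-appˡ _) = atomic-conv refl refl (tr , ts , inj₁ e)
compsConv⇄ tr ts e@(⇄-appʳ _) = atomic-conv refl refl (tr , ts , inj₁ e)
compsConv⇄ tr ts (⇄-pairˡ {t = t} e) = ≈ᶜ-++ʳ (comps t) (compsConv⇄ (T-pairˡ tr) (T-pairˡ ts) e)
compsConv⇄ tr ts (⇄-pairʳ {t = t} e) = ≈ᶜ-++ˡ (comps t) (compsConv⇄ (T-pairʳ tr) (T-pairʳ ts) e)
compsConv⇄ tr ts e@(⇄-proj _) = atomic-conv refl refl (tr , ts , inj₁ e)

rename-comps : ∀ x y r → ty y ≡ᵀ ty x → y ∉ fv (ƛ x r) → ∀ L → (∀ {c} → c ∈ L → c ∈ comps r) →
               Pointwise _~_ (map (ƛ x) L) (map (ƛ y) (map (sub (extend `_ x (` y))) L))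
rename-comps x y r e y∉ [] h = []
rename-comps x y r e y∉ (c ∷ L) h =
  (α-rename e (y∉ ∘ comps-fv (ƛ x r) (MP.∈-map⁺ (ƛ x) (h (here refl)))) ◅ ε)
  ∷ rename-comps x y r e y∉ L (h ∘ there)

compsα : ∀ {r s} → Term r → Term s → r =α s → comps r ≈ᶜ comps s
compsα tr ts (α-rename {x} {y} {r} e y∉) =
  conv (~⇒⇄*-pointwise (T-comps tr)
         (PW.transitive _◅◅_ (rename-comps x y r e y∉ (comps r) (λ m → m))
           (PW.map⁺ (ƛ y) (ƛ y) (PW.map ~lam
             (PW.symmetric (Star.reverse α-sym) (comps-sub r (extend `_ x (` y)) (extend-ren x y id-ren)))))))
  ◅ ε
compsα tr ts (α-sym p) = ≈ᶜ-sym (compsα ts tr p)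
compsα tr ts (α-lam p) = ≈ᶜ-lam (compsα (T-lam⁻ tr) (T-lam⁻ ts) p)
compsα tr ts p@(α-appˡ _) = atomic-conv refl refl (tr , ts , inj₂ p)
compsα tr ts p@(α-appʳ _) = atomic-conv refl refl (tr , ts , inj₂ p)
compsα tr ts (α-pairˡ {t = t} p) = ≈ᶜ-++ʳ (comps t) (compsα (T-pairˡ tr) (T-pairˡ ts) p)
compsα tr ts (α-pairʳ {t = t} p) = ≈ᶜ-++ˡ (comps t) (compsα (T-pairʳ tr) (T-pairʳ ts) p)
compsα tr ts p@(α-proj _) = atomic-conv refl refl (tr , ts , inj₂ p)

compsConv* : ∀ {r s} → r ⇄* s → comps r ≈ᶜ comps s
compsConv* ε = ε
compsConv* ((tr , ts , inj₁ e) ◅ c) = compsConv⇄ tr ts e ◅◅ compsConv* c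
compsConv* ((tr , ts , inj₂ p) ◅ c) = compsα tr ts p ◅◅ compsConv* c

Focus : Tm → Tm → Set
Focus u v = ∃₂ λ L1 L2 → ∃₂ λ c d →
  comps u ≡ L1 ++ c ∷ L2 × comps v ≡ L1 ++ comps d ++ L2 × c ⟶ d

focus-atomic : ∀ {u v} → Atomic u → u ⟶ v → Focus u v
focus-atomic {u} {v} au st = [] , [] , u , v , au , sym (LP.++-identityʳ (comps v)) , st

focus-lam : ∀ {x r s} → Focus r s → Focus (ƛ x r) (ƛ x s)
focus-lam {x} {r} {s} (L1 , L2 , c , d , e1 , e2 , st) =
  map (ƛ x) L1 , map (ƛ x) L2 , ƛ x c , ƛ x d ,
  (begin
    map (ƛ x) (comps r)                       ≡⟨ cong (map (ƛ x)) e1 ⟩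
    map (ƛ x) (L1 ++ c ∷ L2)                  ≡⟨ LP.map-++ (ƛ x) L1 (c ∷ L2) ⟩
    map (ƛ x) L1 ++ ƛ x c ∷ map (ƛ x) L2       ∎) ,
  (begin
    map (ƛ x) (comps s)                       ≡⟨ cong (map (ƛ x)) e2 ⟩
    map (ƛ x) (L1 ++ comps d ++ L2)           ≡⟨ LP.map-++ (ƛ x) L1 (comps d ++ L2) ⟩
    map (ƛ x) L1 ++ map (ƛ x) (comps d ++ L2) ≡⟨ cong (map (ƛ x) L1 ++_) (LP.map-++ (ƛ x) (comps d) L2) ⟩
    map (ƛ x) L1 ++ comps (ƛ x d) ++ map (ƛ x) L2 ∎) ,
  ⟶-↪ (↪-lam st)

focus-pairˡ : ∀ {r s t} → Focus r s → Focus (r ⊗ t) (s ⊗ t)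
focus-pairˡ {r} {s} {t} (L1 , L2 , c , d , e1 , e2 , st) =
  L1 , L2 ++ comps t , c , d ,
  (begin
    comps r ++ comps t         ≡⟨ cong (_++ comps t) e1 ⟩
    (L1 ++ c ∷ L2) ++ comps t  ≡⟨ LP.++-assoc L1 (c ∷ L2) (comps t) ⟩
    L1 ++ c ∷ L2 ++ comps t    ∎) ,
  (begin
    comps s ++ comps t                 ≡⟨ cong (_++ comps t) e2 ⟩
    (L1 ++ comps d ++ L2) ++ comps t   ≡⟨ LP.++-assoc L1 (comps d ++ L2) (comps t) ⟩
    L1 ++ (comps d ++ L2) ++ comps t   ≡⟨ cong (L1 ++_) (LP.++-assoc (comps d) L2 (comps t)) ⟩
    L1 ++ comps d ++ L2 ++ comps t     ∎) ,
  st

focus-pairʳ : ∀ {r s t} → Focus r s → Focus (t ⊗ r) (t ⊗ s)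
focus-pairʳ {r} {s} {t} (L1 , L2 , c , d , e1 , e2 , st) =
  comps t ++ L1 , L2 , c , d ,
  (begin
    comps t ++ comps r          ≡⟨ cong (comps t ++_) e1 ⟩
    comps t ++ L1 ++ c ∷ L2     ≡⟨ sym (LP.++-assoc (comps t) L1 (c ∷ L2)) ⟩
    (comps t ++ L1) ++ c ∷ L2   ∎) ,
  (begin
    comps t ++ comps s                  ≡⟨ cong (comps t ++_) e2 ⟩
    comps t ++ L1 ++ comps d ++ L2      ≡⟨ sym (LP.++-assoc (comps t) L1 (comps d ++ L2)) ⟩
    (comps t ++ L1) ++ comps d ++ L2    ∎) ,
  st

βπζ-atomic : ∀ {r s} → r →βπζ s → Atomic r
βπζ-atomic (β _ _) = refl
βπζ-atomic (π-red _) = refl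
βπζ-atomic ζ = refl

elim-atomic : ∀ {r} → ElimOrVar r → Atomic r
elim-atomic ev-var = refl
elim-atomic ev-app = refl
elim-atomic ev-proj = refl

ηδ-atomic : ∀ {r s} → r →ηδ s → Atomic r
ηδ-atomic (η _ ev _ _) = elim-atomic ev
ηδ-atomic (δ _ ev) = elim-atomic ev

mutual
  focus⟶ : ∀ {u v} → u ⟶ v → Focus u v
  focus⟶ (⟶-ηδ st) = focus-atomic (ηδ-atomic st) (⟶-ηδ st)
  focus⟶ (⟶-↪ st) = focus↪ st

  focus↪ : ∀ {u v} → u ↪ v → Focus u v
  focus↪ (↪-βπζ st) = focus-atomic (βπζ-atomic st) (⟶-↪ (↪-βπζ st))
  focus↪ (↪-lam {x} {r} {s} st) = focus-lam {x} {r} {s} (focus⟶ st)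
  focus↪ st@(↪-appˡ _) = focus-atomic refl (⟶-↪ st)
  focus↪ st@(↪-appʳ _) = focus-atomic refl (⟶-↪ st)
  focus↪ (↪-pairˡ {r} {s} {t} st) = focus-pairˡ {r} {s} {t} (focus⟶ st)
  focus↪ (↪-pairʳ {r} {s} {t} st) = focus-pairʳ {r} {s} {t} (focus⟶ st)
  focus↪ st@(↪-proj _) = focus-atomic refl (⟶-↪ st)

reduceComponent : ∀ {t c d} A1 c0 A2 → Term t → comps t ≡ A1 ++ c0 ∷ A2 → c0 ⇄* c → c ⟶ d → Term d →
                  t ⇝ prodL (A1 ++ d ∷ A2) × comps (prodL (A1 ++ d ∷ A2)) ≡ A1 ++ comps d ++ A2
reduceComponent {t} {d = d} A1 c0 A2 tt e h0 st td =
  (tt , T-prodL tL' , _ , _ ,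
   subst (λ L → t ⇄* prodL L) e (flatten t tt) ◅◅ prodL-conv (PW.++⁺ (PW.refl ε) (h0 ∷ PW.refl ε)) tL ,
   prodL-step A1 A2 st , ε) ,
  (begin
    comps (prodL (A1 ++ d ∷ A2))                          ≡⟨ comps-prodL-insert A1 d A2 ⟩
    concatMap comps (A1 ++ d ∷ A2)                        ≡⟨ LP.concatMap-++ comps A1 (d ∷ A2) ⟩
    concatMap comps A1 ++ comps d ++ concatMap comps A2   ≡⟨ cong₂ (λ X Y → X ++ comps d ++ Y)
                                                               (concatMap-atomic A1 (AllP.++⁻ˡ A1 atomic))
                                                               (concatMap-atomic A2 (All.tail (AllP.++⁻ʳ A1 atomic))) ⟩
    A1 ++ comps d ++ A2                                   ∎)
  where
  tL : All Term (A1 ++ c0 ∷ A2)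
  tL = subst (All Term) e (T-comps tt)
  tL' : All Term (A1 ++ d ∷ A2)
  tL' = AllP.++⁺ (AllP.++⁻ˡ A1 tL) (td ∷ All.tail (AllP.++⁻ʳ A1 tL))
  atomic : All Atomic (A1 ++ c0 ∷ A2)
  atomic = subst (All Atomic) e (All.tabulate (comps-atomic t))

leftFactorStep : ∀ {a b v c d} A1 c0 A2 L1 L2 → Term a → Term b → Term v →
                 comps a ≡ A1 ++ c0 ∷ A2 → c0 ⇄* c → c ⟶ d → comps v ≡ L1 ++ comps d ++ L2 →
                 A1 ++ A2 ++ comps b ≈ᶜ L1 ++ L2 → ∃[ a' ] (a ⇝ a' × v ⇄* a' ⊗ b)
leftFactorStep {b = b} {v} {d = d} A1 c0 A2 L1 L2 ta tb tv ea h0 st ev R =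
  a' , a⇝a' , ≈ᶜ⇒⇄* tv (T-pair (proj₁ (proj₂ a⇝a')) tb) v≈a'b
  where
  a' = prodL (A1 ++ d ∷ A2)
  reduct = reduceComponent A1 c0 A2 ta ea h0 st (T-block L1 L2 tv ev)
  a⇝a' = proj₁ reduct
  v≈a'b : comps v ≈ᶜ comps a' ++ comps b
  v≈a'b = ≡⇒≈ᶜ ev ◅◅ ≈ᶜ-sym (≈ᶜ-insert (comps d) A1 (A2 ++ comps b) L1 L2 R) ◅◅ ≡⇒≈ᶜ (begin
    A1 ++ comps d ++ A2 ++ comps b     ≡⟨ cong (A1 ++_) (sym (LP.++-assoc (comps d) A2 (comps b))) ⟩
    A1 ++ (comps d ++ A2) ++ comps b   ≡⟨ sym (LP.++-assoc A1 (comps d ++ A2) (comps b)) ⟩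
    (A1 ++ comps d ++ A2) ++ comps b   ≡⟨ cong (_++ comps b) (sym (proj₂ reduct)) ⟩
    comps a' ++ comps b                ∎)

split-++ : ∀ (xs ys K1 : List Tm) c K2 → xs ++ ys ≡ K1 ++ c ∷ K2 →
  (∃₂ λ A1 A2 → xs ≡ A1 ++ c ∷ A2 × K1 ≡ A1 × K2 ≡ A2 ++ ys) ⊎
  (∃₂ λ B1 B2 → ys ≡ B1 ++ c ∷ B2 × K1 ≡ xs ++ B1 × K2 ≡ B2)
split-++ [] ys K1 c K2 e = inj₂ (K1 , K2 , e , refl , refl)
split-++ (x ∷ xs) ys [] c K2 refl = inj₁ ([] , xs , refl , refl , refl)
split-++ (x ∷ xs) ys (k ∷ K1) c K2 e with LP.∷-injective e
... | refl , e' with split-++ xs ys K1 c K2 e'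
... | inj₁ (A1 , A2 , e1 , refl , e3) = inj₁ (x ∷ A1 , A2 , cong (x ∷_) e1 , refl , e3)
... | inj₂ (B1 , B2 , e1 , refl , e3) = inj₂ (B1 , B2 , e1 , refl , e3)

productStep : ∀ {a b u v} → Term a → Term b → a ⊗ b ⇄* u → u ⟶ v → Term v →
              (∃[ a' ] (a ⇝ a' × v ⇄* a' ⊗ b)) ⊎ (∃[ b' ] (b ⇝ b' × v ⇄* a ⊗ b'))
productStep {a} {b} ta tb ch st tv with focus⟶ st
... | L1 , L2 , c , d , eu , ev , st' with counterpart (compsConv* ch) L1 c L2 eu
... | K1 , K2 , c0 , eL , h0 , R with split-++ (comps a) (comps b) K1 c0 K2 eL
... | inj₁ (A1 , A2 , ea , refl , refl) =
  inj₁ (leftFactorStep A1 c0 A2 L1 L2 ta tb tv ea h0 st' ev R)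
... | inj₂ (B1 , B2 , eb , refl , refl) =
  let (b' , b⇝b' , v⇄b'a) = leftFactorStep B1 c0 B2 L1 L2 tb ta tv eb h0 st' ev (perm rotate ◅ R)
      tb' = proj₁ (proj₂ b⇝b')
  in inj₂ (b' , b⇝b' , v⇄b'a ◅◅ ⇄-single (T-pair tb' ta) (T-pair ta tb') ⇄-comm)
  where
  rotate : B1 ++ B2 ++ comps a ↭ (comps a ++ B1) ++ B2
  rotate = trans (↭-reflexive (sym (LP.++-assoc B1 B2 (comps a))))
           (trans (PP.++-comm (B1 ++ B2) (comps a)) (↭-reflexive (sym (LP.++-assoc (comps a) B1 B2))))

Reduct : Tm → Tm → Set
Reduct s t = t ⇝ s

acc-⇄* : ∀ {x y} → Term x → x ⇄* y → Acc Reduct y → Acc Reduct x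
acc-⇄* tx c (acc rs) = acc λ (_ , tz , r' , s' , c1 , st , c2) →
  rs (⇄*-target tx c , tz , r' , s' , ⇄*-sym c ◅◅ c1 , st , c2)

-- Products of accessible terms are accessible, by nested induction: every
-- reduct of a ⊗ b is convertible to a' ⊗ b or a ⊗ b' with a smaller factor.
accProduct : ∀ {a b} → Term a → Term b → Acc Reduct a → Acc Reduct b → Acc Reduct (a ⊗ b)
accProduct {a} {b} ta tb A@(acc ra) B@(acc rb) = acc λ (_ , tw , _ , _ , c1 , st , c2) →
  let (_ , v⇄w , acc-w) = reducedFactor (productStep ta tb c1 st (⇄*-source tw c2))
  in acc-⇄* tw (⇄*-sym c2 ◅◅ v⇄w) acc-w
  where
  reducedFactor : ∀ {v} → (∃[ a' ] (a ⇝ a' × v ⇄* a' ⊗ b)) ⊎ (∃[ b' ] (b ⇝ b' × v ⇄* a ⊗ b')) →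
                  ∃[ w ] (v ⇄* w × Acc Reduct w)
  reducedFactor (inj₁ (a' , a⇝a' , v⇄a'b)) =
    a' ⊗ b , v⇄a'b , accProduct (proj₁ (proj₂ a⇝a')) tb (ra a⇝a') B
  reducedFactor (inj₂ (b' , b⇝b' , v⇄ab')) =
    a ⊗ b' , v⇄ab' , accProduct ta (proj₁ (proj₂ b⇝b')) A (rb b⇝b')

mainTheorem12 : ∀ (r₁ r₂ : Tm) → SN r₁ → SN r₂ → SN (r₁ ⊗ r₂)
mainTheorem12 r₁ r₂ (t₁ , a₁) (t₂ , a₂) = T-pair t₁ t₂ , accProduct t₁ t₂ a₁ a₂
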